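{- Let $M$ be a supersolvable saturated matroid and let $C$ be a circuit of $M$ with $|C|\geq 4$. Then there exist distinct elements $x,y\in C$ and an element $z\notin C$ such that both $\{x,y,z\}$ and $(C-\{x,y\})\cup\{z\}$ are circuits of $M$.
   Context: A flat $F$ of a matroid $M$ is modular if $r(F)+r(F')=r(F\cap F')+r(F\cup F')$ for every flat $F'$. A vertical cover of $M$ is a pair $(F,F')$ of flats, neither equal to $E(M)$, with $F\cup F'=E(M)$; a flat $X$ is round if $M|X$ has no vertical cover. A rank-$r$ matroid is supersolvable if it has a chain of modular flats $F_0\subseteq\cdots\subseteq F_r$ with $r(F_i)=i$; it is saturated if every round flat is modular. -}

module Defs where

open import Data.Nat using (ℕ; zero; suc; _+_; _≤_; _<_)
open import Data.Fin using (Fin)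
open import Data.Fin.Subset using (Subset; _∈_; _∉_; _⊆_; _∪_; _∩_; ∣_∣; ⁅_⁆; ⊤; ⊥; _-_)
open import Data.Product using (Σ; _×_; ∃)
open import Relation.Nullary using (¬_)
open import Relation.Binary.PropositionalEquality using (_≡_; _≢_)

record Matroid (n : ℕ) : Set where
  field
    r          : Subset n → ℕ
    r-bounded  : ∀ X → r X ≤ ∣ X ∣
    r-mono     : ∀ X Y → X ⊆ Y → r X ≤ r Y
    r-submod   : ∀ X Y → r (X ∪ Y) + r (X ∩ Y) ≤ r X + r Y

module _ {n : ℕ} (M : Matroid n) where
  open Matroid M

  rank : ℕ
  rank = r ⊤

  Independent : Subset n → Set
  Independent X = r X ≡ ∣ X ∣

  Dependent : Subset n → Set
  Dependent X = ¬ Independent X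

  Circuit : Subset n → Set
  Circuit C = Dependent C × (∀ D → D ⊆ C → D ≢ C → Independent D)

  -- flat of the restriction M|X (for X = ⊤ : flat of M):
  -- F ⊆ X and adding any element of X outside F increases the rank
  FlatIn : Subset n → Subset n → Set
  FlatIn X F = F ⊆ X × (∀ x → x ∈ X → x ∉ F → r F < r (F ∪ ⁅ x ⁆))

  Flat : Subset n → Set
  Flat F = FlatIn ⊤ F

  Modular : Subset n → Set
  Modular F = Flat F × (∀ F' → Flat F' → r F + r F' ≡ r (F ∩ F') + r (F ∪ F'))

  VerticalCoverIn : Subset n → Subset n → Subset n → Set
  VerticalCoverIn X F F' = FlatIn X F × FlatIn X F' × F ≢ X × F' ≢ X × (F ∪ F') ≡ X

  Round : Subset n → Set
  Round X = Flat X × ¬ (Σ (Subset n) λ F → Σ (Subset n) λ F' → VerticalCoverIn X F F')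

  Supersolvable : Set
  Supersolvable = Σ (ℕ → Subset n) λ F →
    (∀ i → i ≤ rank → Modular (F i) × r (F i) ≡ i) ×
    (∀ i → i < rank → F i ⊆ F (suc i))

  Saturated : Set
  Saturated = ∀ X → Round X → Modular X

-- Take consecutive members H ⊆ G of the modular chain with C ⊈ H and C ⊆ G, and two
-- points x, y of C outside H.  Since r G = r H + 1, modularity of H makes the line
-- L = cl {x, y} meet H in a non-loop z, which is parallel to neither x nor y; so L is a
-- round rank-2 flat and hence modular.  Modularity of L against cl (C - x - y), whose
-- join with L has rank only r C = ∣ C ∣ - 1, gives a non-loop w in both.  Then {x, y, w}
-- is a triangle, exchanging x, y for w in C keeps C - x - y ∪ {w} minimally dependent
-- because y ∈ cl {x, w}, and w ∉ C since otherwise the triangle would be a dependent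
-- proper subset of C (this is where ∣ C ∣ ≥ 4 is used).

module Submission where

open import Defs
open import Data.Nat using (ℕ; zero; suc; _+_; _≤_; _<_; _≤?_; z≤n; s≤s)
open import Data.Nat.Properties
  using (≤-refl; ≤-reflexive; ≤-trans; ≤-antisym; <⇒≤; <⇒≱; ≤∧≢⇒<; ≮⇒≥; ≰⇒>; n≤0⇒n≡0; ≤-pred; 1+n≰n;
         m≤m+n; +-comm; +-suc; +-monoʳ-≤; +-monoˡ-≤; +-cancelʳ-≤; +-cancelʳ-<; m<n⇒m<1+n; suc-injective;
         module ≤-Reasoning)
open import Data.Fin using (Fin; zero; suc; _≟_)
open import Data.Fin.Properties using (any?)
open import Data.Fin.Subset
open import Data.Fin.Subset.Properties
open import Data.Vec using (_∷_; []; here; there; tabulate)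
open import Data.Vec.Properties using (lookup∘tabulate; []=⇒lookup; lookup⇒[]=)
open import Data.Product using (Σ; _×_; _,_; proj₁; proj₂; ∃)
open import Data.Sum using (_⊎_; inj₁; inj₂; [_,_]′)
open import Data.Empty using (⊥-elim)
import Data.Empty
open import Function using (_∘_; id)
open import Data.Bool using (true)
open import Relation.Nullary using (¬_; Dec; yes; no; does; contradiction; ¬?)
open import Relation.Nullary.Decidable using (_×-dec_; dec-true; decidable-stable)
open import Relation.Unary using (Decidable)
open import Relation.Binary.PropositionalEquality

private
  variable
    n : ℕ
    p q : Subset n
    x y : Fin n

⁅⁆-⊆ : x ∈ p → ⁅ x ⁆ ⊆ p
⁅⁆-⊆ {p = p} x∈p y∈⁅x⁆ = subst (_∈ p) (sym (x∈⁅y⁆⇒x≡y _ y∈⁅x⁆)) x∈p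

∪-⊆ : ∀ {s} → p ⊆ s → q ⊆ s → p ∪ q ⊆ s
∪-⊆ {p = p} {q} p⊆s q⊆s x∈p∪q = [ p⊆s , q⊆s ]′ (x∈p∪q⁻ p q x∈p∪q)

⊈⇒∃ : p ⊈ q → ∃ λ x → x ∈ p × x ∉ q
⊈⇒∃ {p = p} {q} p⊈q with any? (λ x → x ∈? p ×-dec ¬? (x ∈? q))
... | yes witness = witness
... | no ∄ = ⊥-elim (p⊈q λ {x} x∈p → decidable-stable (x ∈? q) (λ x∉q → ∄ (x , x∈p , x∉q)))

x∉p-x : ∀ (p : Subset n) x → x ∉ p - x
x∉p-x (_ ∷ p) zero    ()
x∉p-x (_ ∷ p) (suc x) (there x∈p-x) = x∉p-x p x x∈p-x

x∈p-y⇒x≢y : x ∈ p - y → x ≢ y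
x∈p-y⇒x≢y {p = p} x∈p-x refl = x∉p-x p _ x∈p-x

x∈p-y⇒x∈p : x ∈ p - y → x ∈ p
x∈p-y⇒x∈p {p = p} = p─q⊆p p _

⊆-minus : p ⊆ q → x ∉ p → p ⊆ q - x
⊆-minus {p = p} p⊆q x∉p y∈p = x∈p∧x≢y⇒x∈p-y (p⊆q y∈p) λ { refl → x∉p y∈p }

∈-minus-cases : y ∈ p → y ≡ x ⊎ y ∈ p - x
∈-minus-cases {y = y} {x = x} y∈p with y ≟ x
... | yes y≡x = inj₁ y≡x
... | no  y≢x = inj₂ (x∈p∧x≢y⇒x∈p-y y∈p y≢x)

p∪⁅x⁆-x⊆p : (p ∪ ⁅ x ⁆) - x ⊆ p
p∪⁅x⁆-x⊆p {p = p} {x} y∈ = [ id , (λ y∈⁅x⁆ → contradiction (x∈⁅y⁆⇒x≡y x y∈⁅x⁆) (x∈p-y⇒x≢y y∈)) ]′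
  (x∈p∪q⁻ p ⁅ x ⁆ (x∈p-y⇒x∈p y∈))

∈⁅x,y,z⁆⁻ : ∀ {w z : Fin n} → w ∈ ⁅ x ⁆ ∪ ⁅ y ⁆ ∪ ⁅ z ⁆ → w ≡ x ⊎ w ≡ y ⊎ w ≡ z
∈⁅x,y,z⁆⁻ {x = x} {y} {w} {z} w∈ with x∈p∪q⁻ ⁅ x ⁆ (⁅ y ⁆ ∪ ⁅ z ⁆) w∈
... | inj₁ w∈⁅x⁆ = inj₁ (x∈⁅y⁆⇒x≡y x w∈⁅x⁆)
... | inj₂ w∈⁅y,z⁆ with x∈p∪q⁻ ⁅ y ⁆ ⁅ z ⁆ w∈⁅y,z⁆
...   | inj₁ w∈⁅y⁆ = inj₂ (inj₁ (x∈⁅y⁆⇒x≡y y w∈⁅y⁆))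
...   | inj₂ w∈⁅z⁆ = inj₂ (inj₂ (x∈⁅y⁆⇒x≡y z w∈⁅z⁆))

∣p∣≡∣q∣+∣p─q∣ : ∀ {p q : Subset n} → q ⊆ p → ∣ p ∣ ≡ ∣ q ∣ + ∣ p ─ q ∣
∣p∣≡∣q∣+∣p─q∣ {p = []}          {q = []}           _   = refl
∣p∣≡∣q∣+∣p─q∣ {p = inside ∷ p}   {q = inside ∷ q}   q⊆p = cong suc (∣p∣≡∣q∣+∣p─q∣ (drop-∷-⊆ q⊆p))
∣p∣≡∣q∣+∣p─q∣ {p = inside ∷ p}   {q = outside ∷ q}  q⊆p =
  trans (cong suc (∣p∣≡∣q∣+∣p─q∣ (drop-∷-⊆ q⊆p))) (sym (+-suc ∣ q ∣ ∣ p ─ q ∣))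
∣p∣≡∣q∣+∣p─q∣ {p = outside ∷ p}  {q = outside ∷ q}  q⊆p = ∣p∣≡∣q∣+∣p─q∣ (drop-∷-⊆ q⊆p)
∣p∣≡∣q∣+∣p─q∣ {p = outside ∷ p}  {q = inside ∷ q}   q⊆p with () ← q⊆p here

∣p∣≡1+∣p-x∣ : x ∈ p → ∣ p ∣ ≡ suc ∣ p - x ∣
∣p∣≡1+∣p-x∣ {x = x} {p} x∈p =
  trans (∣p∣≡∣q∣+∣p─q∣ (⁅⁆-⊆ x∈p)) (cong (_+ ∣ p - x ∣) (∣⁅x⁆∣≡1 x))

∣p∪⁅x⁆∣≡1+∣p∣ : ∀ {x : Fin n} {p} → x ∉ p → ∣ p ∪ ⁅ x ⁆ ∣ ≡ suc ∣ p ∣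
∣p∪⁅x⁆∣≡1+∣p∣ {x = zero}  {p = outside ∷ p} _   = cong suc (cong ∣_∣ (∪-identityʳ p))
∣p∪⁅x⁆∣≡1+∣p∣ {x = zero}  {p = inside ∷ p}  x∉p = contradiction here x∉p
∣p∪⁅x⁆∣≡1+∣p∣ {x = suc x} {p = outside ∷ p} x∉p = ∣p∪⁅x⁆∣≡1+∣p∣ (x∉p ∘ there)
∣p∪⁅x⁆∣≡1+∣p∣ {x = suc x} {p = inside ∷ p}  x∉p = cong suc (∣p∪⁅x⁆∣≡1+∣p∣ (x∉p ∘ there))

∣⁅x⁆∪⁅y⁆∣≡2 : x ≢ y → ∣ ⁅ x ⁆ ∪ ⁅ y ⁆ ∣ ≡ 2
∣⁅x⁆∪⁅y⁆∣≡2 {x = x} x≢y =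
  trans (∣p∪⁅x⁆∣≡1+∣p∣ (x≢y⇒x∉⁅y⁆ (x≢y ∘ sym))) (cong suc (∣⁅x⁆∣≡1 x))

∣⁅x⁆∪⁅y⁆∪⁅z⁆∣≡3 : ∀ {z : Fin n} → x ≢ y → x ≢ z → y ≢ z → ∣ ⁅ x ⁆ ∪ ⁅ y ⁆ ∪ ⁅ z ⁆ ∣ ≡ 3
∣⁅x⁆∪⁅y⁆∪⁅z⁆∣≡3 {x = x} {y} {z} x≢y x≢z y≢z = begin
  ∣ ⁅ x ⁆ ∪ ⁅ y ⁆ ∪ ⁅ z ⁆ ∣    ≡⟨ cong ∣_∣ (∪-comm ⁅ x ⁆ (⁅ y ⁆ ∪ ⁅ z ⁆)) ⟩
  ∣ (⁅ y ⁆ ∪ ⁅ z ⁆) ∪ ⁅ x ⁆ ∣  ≡⟨ ∣p∪⁅x⁆∣≡1+∣p∣ x∉⁅y,z⁆ ⟩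
  suc ∣ ⁅ y ⁆ ∪ ⁅ z ⁆ ∣        ≡⟨ cong suc (∣⁅x⁆∪⁅y⁆∣≡2 y≢z) ⟩
  3                            ∎
  where
  open ≡-Reasoning
  x∉⁅y,z⁆ : x ∉ ⁅ y ⁆ ∪ ⁅ z ⁆
  x∉⁅y,z⁆ x∈ = [ x≢y ∘ x∈⁅y⁆⇒x≡y y , x≢z ∘ x∈⁅y⁆⇒x≡y z ]′ (x∈p∪q⁻ ⁅ y ⁆ ⁅ z ⁆ x∈)

switch-point : ∀ {P : ℕ → Set} → Decidable P → ¬ P 0 →
               ∀ {j} → P j → ∃ λ i → i < j × ¬ P i × P (suc i)
switch-point P? ¬P₀ {zero}  P₀ = contradiction P₀ ¬P₀
switch-point P? ¬P₀ {suc j} Pⱼ₊₁ with P? j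
... | no ¬Pⱼ = j , ≤-refl , ¬Pⱼ , Pⱼ₊₁
... | yes Pⱼ with switch-point P? ¬P₀ Pⱼ
...   | i , i<j , ¬Pᵢ , Pᵢ₊₁ = i , m<n⇒m<1+n i<j , ¬Pᵢ , Pᵢ₊₁

module MatroidProperties {n : ℕ} (M : Matroid n) where
  open Matroid M
  open ≤-Reasoning

  private
    variable
      X Y A F G : Subset n
      a b c : Fin n

  ⊆⇒r≤ : X ⊆ Y → r X ≤ r Y
  ⊆⇒r≤ = r-mono _ _

  r⊥≡0 : r ⊥ ≡ 0
  r⊥≡0 = n≤0⇒n≡0 (≤-trans (r-bounded ⊥) (≤-reflexive (∣⊥∣≡0 n)))

  r-∪⁅⁆ : r (X ∪ ⁅ a ⁆) ≤ suc (r X)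
  r-∪⁅⁆ {X} {a} = begin
    r (X ∪ ⁅ a ⁆)                   ≤⟨ m≤m+n _ _ ⟩
    r (X ∪ ⁅ a ⁆) + r (X ∩ ⁅ a ⁆)   ≤⟨ r-submod X ⁅ a ⁆ ⟩
    r X + r ⁅ a ⁆                   ≤⟨ +-monoʳ-≤ (r X) (≤-trans (r-bounded ⁅ a ⁆) (≤-reflexive (∣⁅x⁆∣≡1 a))) ⟩
    r X + 1                         ≡⟨ +-comm (r X) 1 ⟩
    suc (r X)                       ∎

  ∣∣≤r⇒independent : ∣ X ∣ ≤ r X → Independent M X
  ∣∣≤r⇒independent = ≤-antisym (r-bounded _)

  dependent⇒r<∣∣ : Dependent M X → r X < ∣ X ∣
  dependent⇒r<∣∣ = ≤∧≢⇒< (r-bounded _)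

  cl : Subset n → Subset n
  cl X = tabulate λ a → does (r (X ∪ ⁅ a ⁆) ≤? r X)

  ∈cl⁺ : r (X ∪ ⁅ a ⁆) ≤ r X → a ∈ cl X
  ∈cl⁺ {X} {a} spans = lookup⇒[]= a (cl X)
    (trans (lookup∘tabulate _ a) (dec-true (r (X ∪ ⁅ a ⁆) ≤? r X) spans))

  ∈cl⁻ : a ∈ cl X → r (X ∪ ⁅ a ⁆) ≤ r X
  ∈cl⁻ {a} {X} a∈clX =
    does-true (r (X ∪ ⁅ a ⁆) ≤? r X) (trans (sym (lookup∘tabulate _ a)) ([]=⇒lookup a∈clX))
    where
    does-true : ∀ {P : Set} (P? : Dec P) → does P? ≡ true → P
    does-true (yes p) _ = p

  X⊆clX : X ⊆ cl X
  X⊆clX a∈X = ∈cl⁺ (⊆⇒r≤ (∪-⊆ ⊆-refl (⁅⁆-⊆ a∈X)))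

  cl-mono : X ⊆ Y → cl X ⊆ cl Y
  cl-mono {X} {Y} X⊆Y {a} a∈clX = ∈cl⁺ (+-cancelʳ-≤ (r X) _ _ (begin
    r (Y ∪ ⁅ a ⁆) + r X                         ≤⟨ +-monoˡ-≤ (r X) (⊆⇒r≤ (∪-⊆ (p⊆p∪q _) (q⊆p∪q Y _ ∘ q⊆p∪q X _))) ⟩
    r (Y ∪ (X ∪ ⁅ a ⁆)) + r X                   ≤⟨ +-monoʳ-≤ _ (⊆⇒r≤ (λ b∈X → x∈p∩q⁺ (X⊆Y b∈X , p⊆p∪q _ b∈X))) ⟩
    r (Y ∪ (X ∪ ⁅ a ⁆)) + r (Y ∩ (X ∪ ⁅ a ⁆))   ≤⟨ r-submod Y (X ∪ ⁅ a ⁆) ⟩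
    r Y + r (X ∪ ⁅ a ⁆)                         ≤⟨ +-monoʳ-≤ (r Y) (∈cl⁻ a∈clX) ⟩
    r Y + r X                                   ∎))

  r-∪-⊆cl : ∀ k A → ∣ A ∣ ≤ k → A ⊆ cl X → r (X ∪ A) ≤ r X
  r-∪-⊆cl _ A _ _ with nonempty? A
  r-∪-⊆cl _ A _ _ | no A-empty = ⊆⇒r≤ (∪-⊆ ⊆-refl λ a∈A → ⊥-elim (A-empty (_ , a∈A)))
  r-∪-⊆cl zero A ∣A∣≤0 _ | yes (a , a∈A) =
    contradiction (≤-trans (≤-reflexive (sym (∣p∣≡1+∣p-x∣ a∈A))) ∣A∣≤0) λ ()
  r-∪-⊆cl {X} (suc k) A ∣A∣≤1+k A⊆clX | yes (a , a∈A) = begin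
    r (X ∪ A)                    ≤⟨ ⊆⇒r≤ (∪-⊆ (p⊆p∪q _ ∘ p⊆p∪q _) A⊆X∪[A-a]∪⁅a⁆) ⟩
    r ((X ∪ (A - a)) ∪ ⁅ a ⁆)    ≤⟨ ∈cl⁻ (cl-mono (p⊆p∪q _) (A⊆clX a∈A)) ⟩
    r (X ∪ (A - a))              ≤⟨ r-∪-⊆cl k (A - a) ∣A-a∣≤k (A⊆clX ∘ x∈p-y⇒x∈p) ⟩
    r X                          ∎
    where
    A⊆X∪[A-a]∪⁅a⁆ : A ⊆ (X ∪ (A - a)) ∪ ⁅ a ⁆
    A⊆X∪[A-a]∪⁅a⁆ b∈A with ∈-minus-cases {x = a} b∈A
    ... | inj₁ refl  = q⊆p∪q _ _ (x∈⁅x⁆ a)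
    ... | inj₂ b∈A-a = p⊆p∪q _ (q⊆p∪q X _ b∈A-a)
    ∣A-a∣≤k : ∣ A - a ∣ ≤ k
    ∣A-a∣≤k = ≤-pred (≤-trans (≤-reflexive (sym (∣p∣≡1+∣p-x∣ a∈A))) ∣A∣≤1+k)

  r-cl : r (cl X) ≡ r X
  r-cl {X} = ≤-antisym
    (≤-trans (⊆⇒r≤ (q⊆p∪q X _)) (r-∪-⊆cl n (cl X) (∣p∣≤n (cl X)) ⊆-refl))
    (⊆⇒r≤ X⊆clX)

  ⊆cl⇒r≤ : A ⊆ cl X → r A ≤ r X
  ⊆cl⇒r≤ A⊆clX = ≤-trans (⊆⇒r≤ A⊆clX) (≤-reflexive r-cl)

  cl-flat : Flat M (cl X)
  cl-flat {X} = (λ _ → ∈⊤) , λ a _ a∉clX → begin-strict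
    r (cl X)          ≡⟨ r-cl ⟩
    r X               <⟨ ≰⇒> (a∉clX ∘ ∈cl⁺) ⟩
    r (X ∪ ⁅ a ⁆)     ≤⟨ ⊆⇒r≤ (∪-⊆ (p⊆p∪q _ ∘ X⊆clX) (q⊆p∪q _ _)) ⟩
    r (cl X ∪ ⁅ a ⁆)  ∎

  cl-least : Flat M F → X ⊆ F → cl X ⊆ F
  cl-least {F} F-flat X⊆F {a} a∈clX with a ∈? F
  ... | yes a∈F = a∈F
  ... | no  a∉F = contradiction (∈cl⁻ (cl-mono X⊆F a∈clX)) (<⇒≱ (proj₂ F-flat a ∈⊤ a∉F))

  flat-of-full-rank : Flat M F → rank M ≤ r F → X ⊆ F
  flat-of-full-rank {F} F-flat rank≤rF {a} _ with a ∈? F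
  ... | yes a∈F = a∈F
  ... | no  a∉F = contradiction (≤-trans (⊆⇒r≤ ⊆⊤) rank≤rF) (<⇒≱ (proj₂ F-flat a ∈⊤ a∉F))

  independent-⊆ : ∀ {I D} → Independent M I → D ⊆ I → Independent M D
  independent-⊆ {I} {D} I-indep D⊆I = ∣∣≤r⇒independent (+-cancelʳ-≤ ∣ I ─ D ∣ _ _ (begin
    ∣ D ∣ + ∣ I ─ D ∣        ≡⟨ sym (∣p∣≡∣q∣+∣p─q∣ D⊆I) ⟩
    ∣ I ∣                    ≡⟨ sym I-indep ⟩
    r I                      ≤⟨ ⊆⇒r≤ I⊆D∪[I─D] ⟩
    r (D ∪ (I ─ D))          ≤⟨ m≤m+n _ _ ⟩
    r (D ∪ (I ─ D)) + r (D ∩ (I ─ D))  ≤⟨ r-submod D (I ─ D) ⟩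
    r D + r (I ─ D)          ≤⟨ +-monoʳ-≤ (r D) (r-bounded (I ─ D)) ⟩
    r D + ∣ I ─ D ∣          ∎))
    where
    I⊆D∪[I─D] : I ⊆ D ∪ (I ─ D)
    I⊆D∪[I─D] {a} a∈I with a ∈? D
    ... | yes a∈D = p⊆p∪q _ a∈D
    ... | no  a∉D = q⊆p∪q D _ (x∈p∧x∉q⇒x∈p─q a∈I a∉D)

  ∪⁅⁆-independent⇒∉cl : Independent M (X ∪ ⁅ a ⁆) → a ∉ X → a ∉ cl X
  ∪⁅⁆-independent⇒∉cl {X} {a} indep a∉X a∈clX = 1+n≰n (begin
    suc ∣ X ∣          ≡⟨ sym (∣p∪⁅x⁆∣≡1+∣p∣ a∉X) ⟩
    ∣ X ∪ ⁅ a ⁆ ∣      ≡⟨ sym indep ⟩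
    r (X ∪ ⁅ a ⁆)      ≤⟨ ∈cl⁻ a∈clX ⟩
    r X                ≤⟨ r-bounded X ⟩
    ∣ X ∣              ∎)

  module _ {C} (C-circuit : Circuit M C) where

    circuit-⊆-independent : ∀ {D} → D ⊆ C → a ∈ C → a ∉ D → Independent M D
    circuit-⊆-independent {a = a} {D} D⊆C a∈C a∉D =
      proj₂ C-circuit D D⊆C λ { refl → a∉D a∈C }

    circuit-small-independent : ∀ {D} → D ⊆ C → ∣ D ∣ < ∣ C ∣ → Independent M D
    circuit-small-independent D⊆C ∣D∣<∣C∣ =
      let a , a∈C , a∉D = ⊈⇒∃ (<⇒≱ ∣D∣<∣C∣ ∘ p⊆q⇒∣p∣≤∣q∣)
      in circuit-⊆-independent D⊆C a∈C a∉D

    circuit-minus-independent : a ∈ C → Independent M (C - a)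
    circuit-minus-independent {a} a∈C = circuit-⊆-independent x∈p-y⇒x∈p a∈C (x∉p-x C a)

    circuit-∈cl-minus : a ∈ C → a ∈ cl (C - a)
    circuit-∈cl-minus {a} a∈C = ∈cl⁺ (≤-pred (begin
      suc (r ((C - a) ∪ ⁅ a ⁆))   ≤⟨ s≤s (⊆⇒r≤ (∪-⊆ x∈p-y⇒x∈p (⁅⁆-⊆ a∈C))) ⟩
      suc (r C)                   ≤⟨ dependent⇒r<∣∣ (proj₁ C-circuit) ⟩
      ∣ C ∣                       ≡⟨ ∣p∣≡1+∣p-x∣ a∈C ⟩
      suc ∣ C - a ∣               ≡⟨ cong suc (sym (circuit-minus-independent a∈C)) ⟩
      suc (r (C - a))             ∎))

    circuit-positive-rank : 2 ≤ ∣ C ∣ → 1 ≤ r C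
    circuit-positive-rank 2≤∣C∣ with nonempty? C
    ... | no C-empty =
      contradiction (≤-trans 2≤∣C∣ (≤-reflexive (trans (cong ∣_∣ (Empty-unique C-empty)) (∣⊥∣≡0 n)))) λ ()
    ... | yes (a , a∈C) = begin
      1              ≤⟨ ≤-pred (≤-trans 2≤∣C∣ (≤-reflexive (∣p∣≡1+∣p-x∣ a∈C))) ⟩
      ∣ C - a ∣      ≡⟨ sym (circuit-minus-independent a∈C) ⟩
      r (C - a)      ≤⟨ ⊆⇒r≤ x∈p-y⇒x∈p ⟩
      r C            ∎

  circuit-intro : ∀ {S} → Dependent M S → (∀ {a} → a ∈ S → Independent M (S - a)) → Circuit M S
  circuit-intro {S} S-dependent S-a-independent = S-dependent , λ D D⊆S D≢S →
    let a , a∈S , a∉D = ⊈⇒∃ (D≢S ∘ ⊆-antisym D⊆S)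
    in independent-⊆ (S-a-independent a∈S) (⊆-minus D⊆S a∉D)

  NonLoop : Fin n → Set
  NonLoop a = 1 ≤ r ⁅ a ⁆

  positive-rank⇒nonloop : 1 ≤ r A → ∃ λ a → a ∈ A × NonLoop a
  positive-rank⇒nonloop {A} 1≤rA with any? (λ a → a ∈? A ×-dec 1 ≤? r ⁅ a ⁆)
  ... | yes witness = witness
  ... | no  ∄ = contradiction (≤-trans 1≤rA (≤-trans (⊆cl⇒r≤ A⊆cl⊥) (≤-reflexive r⊥≡0))) λ ()
    where
    A⊆cl⊥ : A ⊆ cl ⊥
    A⊆cl⊥ {a} a∈A = ∈cl⁺ (begin
      r (⊥ ∪ ⁅ a ⁆)  ≡⟨ cong r (∪-identityˡ ⁅ a ⁆) ⟩
      r ⁅ a ⁆        ≤⟨ ≮⇒≥ (λ 0<r⁅a⁆ → ∄ (a , a∈A , 0<r⁅a⁆)) ⟩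
      0              ≡⟨ sym r⊥≡0 ⟩
      r ⊥            ∎)

  modular-meet-nonloop : Modular M F → Flat M G → r (F ∪ G) < r F + r G →
                         ∃ λ a → a ∈ F × a ∈ G × NonLoop a
  modular-meet-nonloop {F} {G} F-modular G-flat r[F∪G]<rF+rG =
    let a , a∈F∩G , a-nonloop = positive-rank⇒nonloop 1≤r[F∩G]
        a∈F , a∈G = x∈p∩q⁻ F G a∈F∩G
    in a , a∈F , a∈G , a-nonloop
    where
    1≤r[F∩G] : 1 ≤ r (F ∩ G)
    1≤r[F∩G] = +-cancelʳ-< (r (F ∪ G)) 0 (r (F ∩ G))
      (≤-trans r[F∪G]<rF+rG (≤-reflexive (proj₂ F-modular G G-flat)))

  IndependentPair : Fin n → Fin n → Set
  IndependentPair a b = 2 ≤ r (⁅ a ⁆ ∪ ⁅ b ⁆)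

  independentPair-sym : IndependentPair a b → IndependentPair b a
  independentPair-sym {a} {b} = subst (λ P → 2 ≤ r P) (∪-comm ⁅ a ⁆ ⁅ b ⁆)

  independentPair⇒≢ : IndependentPair a b → a ≢ b
  independentPair⇒≢ {a} ab refl = 1+n≰n (begin
    2                  ≤⟨ ab ⟩
    r (⁅ a ⁆ ∪ ⁅ a ⁆)  ≡⟨ cong r (∪-idem ⁅ a ⁆) ⟩
    r ⁅ a ⁆            ≤⟨ r-bounded ⁅ a ⁆ ⟩
    ∣ ⁅ a ⁆ ∣          ≡⟨ ∣⁅x⁆∣≡1 a ⟩
    1                  ∎)

  independentPair-r : IndependentPair a b → r (⁅ a ⁆ ∪ ⁅ b ⁆) ≡ 2
  independentPair-r ab =
    ≤-antisym (≤-trans (r-bounded _) (≤-reflexive (∣⁅x⁆∪⁅y⁆∣≡2 (independentPair⇒≢ ab)))) ab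

  independentPair⁺ : NonLoop a → b ∉ cl ⁅ a ⁆ → IndependentPair a b
  independentPair⁺ a-nonloop b∉cl⁅a⁆ = ≤-trans (s≤s a-nonloop) (≰⇒> (b∉cl⁅a⁆ ∘ ∈cl⁺))

  independentPair-across-flat : Flat M F → a ∈ F → NonLoop a → b ∉ F → IndependentPair b a
  independentPair-across-flat F-flat a∈F a-nonloop b∉F =
    independentPair-sym (independentPair⁺ a-nonloop (b∉F ∘ cl-least F-flat (⁅⁆-⊆ a∈F)))

  independentPair-⊆⇒independent : ∣ X ∣ ≡ 2 → a ∈ X → b ∈ X → IndependentPair a b → Independent M X
  independentPair-⊆⇒independent ∣X∣≡2 a∈X b∈X ab =
    ∣∣≤r⇒independent (≤-trans (≤-reflexive ∣X∣≡2) (≤-trans ab (⊆⇒r≤ (∪-⊆ (⁅⁆-⊆ a∈X) (⁅⁆-⊆ b∈X)))))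

  flatIn-proper-r< : ∀ {L} → FlatIn M L F → F ≢ L → r F < r L
  flatIn-proper-r< {F} {L} (F⊆L , F-closed) F≢L =
    let a , a∈L , a∉F = ⊈⇒∃ (F≢L ∘ ⊆-antisym F⊆L)
    in ≤-trans (F-closed a a∈L a∉F) (⊆⇒r≤ (∪-⊆ F⊆L (⁅⁆-⊆ a∈L)))

  -- In a vertical cover of a rank-2 flat both parts have rank at most 1,
  -- so neither contains two of the three points.
  line-round : ∀ {L} → Flat M L → r L ≡ 2 → a ∈ L → b ∈ L → c ∈ L →
               IndependentPair a b → IndependentPair a c → IndependentPair b c → Round M L
  line-round {a} {b} {c} {L} L-flat rL≡2 a∈L b∈L c∈L ab ac bc =
    L-flat , λ (_ , _ , cover) → no-cover cover
    where
    no-pair : ∀ {F d e} → FlatIn M L F → F ≢ L → d ∈ F → e ∈ F → ¬ IndependentPair d e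
    no-pair F-flat F≢L d∈F e∈F de = <⇒≱ (flatIn-proper-r< F-flat F≢L)
      (≤-trans (≤-reflexive rL≡2) (≤-trans de (⊆⇒r≤ (∪-⊆ (⁅⁆-⊆ d∈F) (⁅⁆-⊆ e∈F)))))

    no-cover : ∀ {F₁ F₂} → VerticalCoverIn M L F₁ F₂ → Data.Empty.⊥
    no-cover {F₁} {F₂} (F₁-flat , F₂-flat , F₁≢L , F₂≢L , F₁∪F₂≡L)
      with side a∈L | side b∈L | side c∈L
      where
      side : ∀ {d} → d ∈ L → d ∈ F₁ ⊎ d ∈ F₂
      side {d} d∈L = x∈p∪q⁻ F₁ F₂ (subst (d ∈_) (sym F₁∪F₂≡L) d∈L)
    ... | inj₁ a₁ | inj₁ b₁ | _      = no-pair F₁-flat F₁≢L a₁ b₁ ab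
    ... | inj₂ a₂ | inj₂ b₂ | _      = no-pair F₂-flat F₂≢L a₂ b₂ ab
    ... | inj₁ a₁ | inj₂ _  | inj₁ c₁ = no-pair F₁-flat F₁≢L a₁ c₁ ac
    ... | inj₁ _  | inj₂ b₂ | inj₂ c₂ = no-pair F₂-flat F₂≢L b₂ c₂ bc
    ... | inj₂ _  | inj₁ b₁ | inj₁ c₁ = no-pair F₁-flat F₁≢L b₁ c₁ bc
    ... | inj₂ a₂ | inj₁ _  | inj₂ c₂ = no-pair F₂-flat F₂≢L a₂ c₂ ac

  triangle-circuit : IndependentPair a b → IndependentPair a c → IndependentPair b c →
                     r (⁅ a ⁆ ∪ ⁅ b ⁆ ∪ ⁅ c ⁆) ≤ 2 → Circuit M (⁅ a ⁆ ∪ ⁅ b ⁆ ∪ ⁅ c ⁆)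
  triangle-circuit {a} {b} {c} ab ac bc r≤2 = circuit-intro dependent minus-independent
    where
    S = ⁅ a ⁆ ∪ ⁅ b ⁆ ∪ ⁅ c ⁆
    a≢b = independentPair⇒≢ ab
    a≢c = independentPair⇒≢ ac
    b≢c = independentPair⇒≢ bc
    ∣S∣≡3 : ∣ S ∣ ≡ 3
    ∣S∣≡3 = ∣⁅x⁆∪⁅y⁆∪⁅z⁆∣≡3 a≢b a≢c b≢c
    a∈S : a ∈ S
    a∈S = x∈p∪q⁺ (inj₁ (x∈⁅x⁆ a))
    b∈S : b ∈ S
    b∈S = x∈p∪q⁺ (inj₂ (x∈p∪q⁺ (inj₁ (x∈⁅x⁆ b))))
    c∈S : c ∈ S
    c∈S = x∈p∪q⁺ (inj₂ (x∈p∪q⁺ (inj₂ (x∈⁅x⁆ c))))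
    dependent : Dependent M S
    dependent S-independent = 1+n≰n (≤-trans (≤-reflexive (trans (sym ∣S∣≡3) (sym S-independent))) r≤2)
    ∣S-d∣≡2 : ∀ {d} → d ∈ S → ∣ S - d ∣ ≡ 2
    ∣S-d∣≡2 d∈S = suc-injective (trans (sym (∣p∣≡1+∣p-x∣ d∈S)) ∣S∣≡3)
    minus-independent : ∀ {d} → d ∈ S → Independent M (S - d)
    minus-independent {d} d∈S with ∈⁅x,y,z⁆⁻ d∈S
    ... | inj₁ refl        = independentPair-⊆⇒independent (∣S-d∣≡2 d∈S)
                               (x∈p∧x≢y⇒x∈p-y b∈S (a≢b ∘ sym)) (x∈p∧x≢y⇒x∈p-y c∈S (a≢c ∘ sym)) bc
    ... | inj₂ (inj₁ refl) = independentPair-⊆⇒independent (∣S-d∣≡2 d∈S)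
                               (x∈p∧x≢y⇒x∈p-y a∈S a≢b) (x∈p∧x≢y⇒x∈p-y c∈S (b≢c ∘ sym)) ac
    ... | inj₂ (inj₂ refl) = independentPair-⊆⇒independent (∣S-d∣≡2 d∈S)
                               (x∈p∧x≢y⇒x∈p-y a∈S a≢c) (x∈p∧x≢y⇒x∈p-y b∈S b≢c) ab

  supersolvable⇒modular-cover : Supersolvable M → 1 ≤ r X →
    Σ (Subset n) λ H → Σ (Subset n) λ G →
      Modular M H × Flat M G × H ⊆ G × r G ≡ suc (r H) × X ⊈ H × X ⊆ G
  supersolvable⇒modular-cover {X} (F , F-modular , F-chain) 1≤rX =
    let i , i<rank , X⊈Fᵢ , X⊆Fᵢ₊₁ = switch-point (λ i → X ⊆? F i) X⊈F₀ X⊆F[rank]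
        Fᵢ-modular , rFᵢ≡i = F-modular i (<⇒≤ i<rank)
        Fᵢ₊₁-modular , rFᵢ₊₁≡1+i = F-modular (suc i) i<rank
    in F i , F (suc i) , Fᵢ-modular , proj₁ Fᵢ₊₁-modular , F-chain i i<rank ,
       trans rFᵢ₊₁≡1+i (cong suc (sym rFᵢ≡i)) , X⊈Fᵢ , X⊆Fᵢ₊₁
    where
    X⊈F₀ : X ⊈ F 0
    X⊈F₀ X⊆F₀ = <⇒≱ 1≤rX (≤-trans (⊆⇒r≤ X⊆F₀) (≤-reflexive (proj₂ (F-modular 0 z≤n))))
    X⊆F[rank] : X ⊆ F (rank M)
    X⊆F[rank] = let F[rank]-modular , rF[rank]≡rank = F-modular (rank M) ≤-refl
                in flat-of-full-rank (proj₁ F[rank]-modular) (≤-reflexive (sym rF[rank]≡rank))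

  circuit-two-outside-flat : ∀ {C H} → Circuit M C → Flat M H → C ⊈ H →
    Σ (Fin n) λ x → Σ (Fin n) λ y → x ∈ C × y ∈ C × x ≢ y × x ∉ H × y ∉ H
  circuit-two-outside-flat C-circuit H-flat C⊈H =
    let x , x∈C , x∉H = ⊈⇒∃ C⊈H
        y , y∈C-x , y∉H = ⊈⇒∃ λ C-x⊆H → x∉H (cl-least H-flat C-x⊆H (circuit-∈cl-minus C-circuit x∈C))
    in x , y , x∈C , x∈p-y⇒x∈p y∈C-x , x∈p-y⇒x≢y y∈C-x ∘ sym , x∉H , y∉H

  modular-hyperplane-meets-line : ∀ {H G} → Modular M H → Flat M G → H ⊆ G → r G ≡ suc (r H) →
    a ∈ G → b ∈ G → IndependentPair a b →
    ∃ λ z → z ∈ H × z ∈ cl (⁅ a ⁆ ∪ ⁅ b ⁆) × NonLoop z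
  modular-hyperplane-meets-line {a} {b} {H} {G} H-modular G-flat H⊆G rG≡1+rH a∈G b∈G ab =
    modular-meet-nonloop H-modular cl-flat (begin-strict
      r (H ∪ cl (⁅ a ⁆ ∪ ⁅ b ⁆))    ≤⟨ ⊆⇒r≤ (∪-⊆ H⊆G (cl-least G-flat (∪-⊆ (⁅⁆-⊆ a∈G) (⁅⁆-⊆ b∈G)))) ⟩
      r G                          ≡⟨ rG≡1+rH ⟩
      suc (r H)                    <⟨ ≤-refl ⟩
      suc (suc (r H))              ≡⟨ +-comm 2 (r H) ⟩
      r H + 2                      ≡⟨ cong (r H +_) (sym (trans r-cl (independentPair-r ab))) ⟩
      r H + r (cl (⁅ a ⁆ ∪ ⁅ b ⁆))  ∎)

  module CircuitChord {C} (C-circuit : Circuit M C) {x y} (x∈C : x ∈ C) (y∈C : y ∈ C) (x≢y : x ≢ y) where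

    y∈C-x : y ∈ C - x
    y∈C-x = x∈p∧x≢y⇒x∈p-y y∈C (x≢y ∘ sym)

    C-x-y⊆C : C - x - y ⊆ C
    C-x-y⊆C = x∈p-y⇒x∈p ∘ x∈p-y⇒x∈p

    ∣C∣≡2+∣C-x-y∣ : ∣ C ∣ ≡ 2 + ∣ C - x - y ∣
    ∣C∣≡2+∣C-x-y∣ = trans (∣p∣≡1+∣p-x∣ x∈C) (cong suc (∣p∣≡1+∣p-x∣ y∈C-x))

    C-x-y-independent : Independent M (C - x - y)
    C-x-y-independent = circuit-⊆-independent C-circuit C-x-y⊆C x∈C (x∉p-x C x ∘ x∈p-y⇒x∈p)

    x∉cl[C-x-y] : x ∉ cl (C - x - y)
    x∉cl[C-x-y] = ∪⁅⁆-independent⇒∉cl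
      (independent-⊆ (circuit-minus-independent C-circuit y∈C)
        (∪-⊆ (λ e∈ → x∈p∧x≢y⇒x∈p-y (C-x-y⊆C e∈) (x∈p-y⇒x≢y e∈)) (⁅⁆-⊆ (x∈p∧x≢y⇒x∈p-y x∈C x≢y))))
      (x∉p-x C x ∘ x∈p-y⇒x∈p)

    y∉cl[C-x-y] : y ∉ cl (C - x - y)
    y∉cl[C-x-y] = ∪⁅⁆-independent⇒∉cl
      (independent-⊆ (circuit-minus-independent C-circuit x∈C) (∪-⊆ x∈p-y⇒x∈p (⁅⁆-⊆ y∈C-x)))
      (x∉p-x (C - x) y)

    circuit-independentPair : 3 ≤ ∣ C ∣ → IndependentPair x y
    circuit-independentPair 3≤∣C∣ = begin
      2                  ≡⟨ sym (∣⁅x⁆∪⁅y⁆∣≡2 x≢y) ⟩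
      ∣ ⁅ x ⁆ ∪ ⁅ y ⁆ ∣  ≡⟨ sym (circuit-small-independent C-circuit (∪-⊆ (⁅⁆-⊆ x∈C) (⁅⁆-⊆ y∈C))
                              (≤-trans (s≤s (≤-reflexive (∣⁅x⁆∪⁅y⁆∣≡2 x≢y))) 3≤∣C∣)) ⟩
      r (⁅ x ⁆ ∪ ⁅ y ⁆)  ∎

    module _ (xy : IndependentPair x y) where

      line-meets-C-x-y : Modular M (cl (⁅ x ⁆ ∪ ⁅ y ⁆)) →
        ∃ λ w → w ∈ cl (⁅ x ⁆ ∪ ⁅ y ⁆) × w ∈ cl (C - x - y) × NonLoop w
      line-meets-C-x-y line-modular = modular-meet-nonloop line-modular cl-flat (begin-strict
        r (cl (⁅ x ⁆ ∪ ⁅ y ⁆) ∪ cl (C - x - y))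
          ≤⟨ ⊆cl⇒r≤ (∪-⊆ (cl-mono (∪-⊆ (⁅⁆-⊆ x∈C) (⁅⁆-⊆ y∈C))) (cl-mono C-x-y⊆C)) ⟩
        r C                                       <⟨ dependent⇒r<∣∣ (proj₁ C-circuit) ⟩
        ∣ C ∣                                     ≡⟨ ∣C∣≡2+∣C-x-y∣ ⟩
        2 + ∣ C - x - y ∣                         ≡⟨ cong₂ _+_ (sym (trans r-cl (independentPair-r xy)))
                                                               (sym (trans r-cl C-x-y-independent)) ⟩
        r (cl (⁅ x ⁆ ∪ ⁅ y ⁆)) + r (cl (C - x - y)) ∎)

      module _ {w} (w∈line : w ∈ cl (⁅ x ⁆ ∪ ⁅ y ⁆)) (w∈cl[C-x-y] : w ∈ cl (C - x - y))
               (w-nonloop : NonLoop w) where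

        xw : IndependentPair x w
        xw = independentPair-across-flat cl-flat w∈cl[C-x-y] w-nonloop x∉cl[C-x-y]

        yw : IndependentPair y w
        yw = independentPair-across-flat cl-flat w∈cl[C-x-y] w-nonloop y∉cl[C-x-y]

        triangle : Circuit M (⁅ x ⁆ ∪ ⁅ y ⁆ ∪ ⁅ w ⁆)
        triangle = triangle-circuit xy xw yw (begin
          r (⁅ x ⁆ ∪ ⁅ y ⁆ ∪ ⁅ w ⁆)  ≤⟨ ⊆cl⇒r≤ (∪-⊆ (X⊆clX ∘ p⊆p∪q _) (∪-⊆ (X⊆clX ∘ q⊆p∪q _ _) (⁅⁆-⊆ w∈line))) ⟩
          r (⁅ x ⁆ ∪ ⁅ y ⁆)          ≡⟨ independentPair-r xy ⟩
          2                          ∎)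

        w∉C : 4 ≤ ∣ C ∣ → w ∉ C
        w∉C 4≤∣C∣ w∈C = proj₁ triangle (circuit-small-independent C-circuit
          (∪-⊆ (⁅⁆-⊆ x∈C) (∪-⊆ (⁅⁆-⊆ y∈C) (⁅⁆-⊆ w∈C)))
          (≤-trans (s≤s (≤-reflexive ∣triangle∣≡3)) 4≤∣C∣))
          where
          ∣triangle∣≡3 = ∣⁅x⁆∪⁅y⁆∪⁅z⁆∣≡3 x≢y (independentPair⇒≢ xw) (independentPair⇒≢ yw)

        -- As y ∈ cl {x, w}, the set T ∪ {x} spans C - a, whose rank is ∣ T ∣ + 1.
        exchange-independent : w ∉ C → a ∈ C - x - y → Independent M (((C - x - y) ∪ ⁅ w ⁆) - a)
        exchange-independent {a} w∉C a∈C-x-y = ∣∣≤r⇒independent (≤-pred (begin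
          suc ∣ T ∣                ≡⟨ trans (sym (∣p∣≡1+∣p-x∣ a∈D)) ∣D∣≡1+∣C-x-y∣ ⟩
          suc ∣ C - x - y ∣        ≡⟨ suc-injective (trans (sym ∣C∣≡2+∣C-x-y∣) (∣p∣≡1+∣p-x∣ a∈C)) ⟩
          ∣ C - a ∣                ≡⟨ sym (circuit-minus-independent C-circuit a∈C) ⟩
          r (C - a)                ≤⟨ ⊆cl⇒r≤ C-a⊆cl[T∪⁅x⁆] ⟩
          r (T ∪ ⁅ x ⁆)            ≤⟨ r-∪⁅⁆ ⟩
          suc (r T)                ∎))
          where
          D = (C - x - y) ∪ ⁅ w ⁆
          T = D - a
          a∈C : a ∈ C
          a∈C = C-x-y⊆C a∈C-x-y
          a∈D : a ∈ D
          a∈D = p⊆p∪q _ a∈C-x-y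
          ∣D∣≡1+∣C-x-y∣ : ∣ D ∣ ≡ suc ∣ C - x - y ∣
          ∣D∣≡1+∣C-x-y∣ = ∣p∪⁅x⁆∣≡1+∣p∣ (w∉C ∘ C-x-y⊆C)
          w∈T : w ∈ T
          w∈T = x∈p∧x≢y⇒x∈p-y (q⊆p∪q _ _ (x∈⁅x⁆ w)) λ { refl → w∉C a∈C }
          triangle-y⊆T∪⁅x⁆ : (⁅ x ⁆ ∪ ⁅ y ⁆ ∪ ⁅ w ⁆) - y ⊆ T ∪ ⁅ x ⁆
          triangle-y⊆T∪⁅x⁆ e∈ with ∈⁅x,y,z⁆⁻ (x∈p-y⇒x∈p e∈)
          ... | inj₁ refl        = q⊆p∪q _ _ (x∈⁅x⁆ x)
          ... | inj₂ (inj₁ refl) = contradiction refl (x∈p-y⇒x≢y e∈)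
          ... | inj₂ (inj₂ refl) = p⊆p∪q _ w∈T
          C-a⊆cl[T∪⁅x⁆] : C - a ⊆ cl (T ∪ ⁅ x ⁆)
          C-a⊆cl[T∪⁅x⁆] e∈C-a with ∈-minus-cases {x = x} (x∈p-y⇒x∈p e∈C-a)
          ... | inj₁ refl = X⊆clX (q⊆p∪q _ _ (x∈⁅x⁆ x))
          ... | inj₂ e∈C-x with ∈-minus-cases {x = y} e∈C-x
          ...   | inj₁ refl =
            cl-mono triangle-y⊆T∪⁅x⁆ (circuit-∈cl-minus triangle (x∈p∪q⁺ (inj₂ (x∈p∪q⁺ (inj₁ (x∈⁅x⁆ y))))))
          ...   | inj₂ e∈C-x-y =
            X⊆clX (p⊆p∪q _ (x∈p∧x≢y⇒x∈p-y (p⊆p∪q _ e∈C-x-y) (x∈p-y⇒x≢y e∈C-a)))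

        exchange-circuit : w ∉ C → Circuit M ((C - x - y) ∪ ⁅ w ⁆)
        exchange-circuit w∉C = circuit-intro dependent minus-independent
          where
          dependent : Dependent M ((C - x - y) ∪ ⁅ w ⁆)
          dependent D-independent = 1+n≰n (begin
            suc ∣ C - x - y ∣          ≡⟨ sym (∣p∪⁅x⁆∣≡1+∣p∣ (w∉C ∘ C-x-y⊆C)) ⟩
            ∣ (C - x - y) ∪ ⁅ w ⁆ ∣    ≡⟨ sym D-independent ⟩
            r ((C - x - y) ∪ ⁅ w ⁆)    ≤⟨ ∈cl⁻ w∈cl[C-x-y] ⟩
            r (C - x - y)              ≡⟨ C-x-y-independent ⟩
            ∣ C - x - y ∣              ∎)
          minus-independent : a ∈ (C - x - y) ∪ ⁅ w ⁆ → Independent M (((C - x - y) ∪ ⁅ w ⁆) - a)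
          minus-independent a∈D with x∈p∪q⁻ (C - x - y) ⁅ w ⁆ a∈D
          ... | inj₁ a∈C-x-y = exchange-independent w∉C a∈C-x-y
          ... | inj₂ a∈⁅w⁆ rewrite x∈⁅y⁆⇒x≡y w a∈⁅w⁆ = independent-⊆ C-x-y-independent p∪⁅x⁆-x⊆p

        line-point-circuits : 4 ≤ ∣ C ∣ →
          w ∉ C × Circuit M (⁅ x ⁆ ∪ ⁅ y ⁆ ∪ ⁅ w ⁆) × Circuit M ((C - x - y) ∪ ⁅ w ⁆)
        line-point-circuits 4≤∣C∣ = w∉C 4≤∣C∣ , triangle , exchange-circuit (w∉C 4≤∣C∣)

mainTheorem9 : {n : ℕ} (M : Matroid n) → Supersolvable M → Saturated M →
    (C : Subset n) → Circuit M C → 4 ≤ ∣ C ∣ →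
    Σ (Fin n) λ x → Σ (Fin n) λ y → Σ (Fin n) λ z →
      x ∈ C × y ∈ C × x ≢ y × z ∉ C ×
      Circuit M (⁅ x ⁆ ∪ ⁅ y ⁆ ∪ ⁅ z ⁆) × Circuit M ((C - x - y) ∪ ⁅ z ⁆)
mainTheorem9 M supersolvable saturated C C-circuit 4≤∣C∣ =
  let open MatroidProperties M
      H , G , H-modular , G-flat , H⊆G , rG≡1+rH , C⊈H , C⊆G =
        supersolvable⇒modular-cover supersolvable (circuit-positive-rank C-circuit (≤-trans (s≤s (s≤s z≤n)) 4≤∣C∣))
      x , y , x∈C , y∈C , x≢y , x∉H , y∉H = circuit-two-outside-flat C-circuit (proj₁ H-modular) C⊈H
      open CircuitChord C-circuit x∈C y∈C x≢y
      xy = circuit-independentPair (<⇒≤ 4≤∣C∣)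
      z , z∈H , z∈line , z-nonloop =
        modular-hyperplane-meets-line H-modular G-flat H⊆G rG≡1+rH (C⊆G x∈C) (C⊆G y∈C) xy
      line-modular = saturated _ (line-round cl-flat (trans r-cl (independentPair-r xy))
        (X⊆clX (x∈p∪q⁺ (inj₁ (x∈⁅x⁆ x)))) (X⊆clX (x∈p∪q⁺ (inj₂ (x∈⁅x⁆ y)))) z∈line xy
        (independentPair-across-flat (proj₁ H-modular) z∈H z-nonloop x∉H)
        (independentPair-across-flat (proj₁ H-modular) z∈H z-nonloop y∉H))
      w , w∈line , w∈cl[C-x-y] , w-nonloop = line-meets-C-x-y xy line-modular
      w∉C , triangle , exchange-circuit = line-point-circuits xy w∈line w∈cl[C-x-y] w-nonloop 4≤∣C∣
  in x , y , w , x∈C , y∈C , x≢y , w∉C , triangle , exchange-circuit
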